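{- For $n\ge 2$, $\chi_g^{\infty3}(K_{1,2n+1})=3$ and $\chi_g^{\infty2}(K_{1,2n})\ge 4$.
   Context: $K_{1,r}$ is the star with one centre and $r$ leaves. The eternal vertex colouring game on a graph $G$ with colour set $\{1,\dots,k\}$: Alice and Bob alternately choose vertices, Alice first; the game consists of rounds, and in each round every vertex is chosen exactly once. In the first round, a chosen (uncoloured) vertex is assigned a colour so that the partial colouring is proper. In later rounds, players keep alternating, each choosing a vertex not yet chosen in the current round and assigning it a colour different from its current colour keeping the colouring proper. Bob wins if at some point the chosen vertex has no legal colour; Alice wins if the game continues indefinitely. In the greedy variant, Bob must always assign to the vertex he chooses the smallest legal colour; $\chi_g^{\infty2}(G)$ is the smallest $k$ for which Alice has a winning strategy in this variant. In the variant where both Alice and Bob must always assign the smallest legal colour, $\chi_g^{\infty3}(G)$ is the smallest $k$ for which Alice wins. -}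

module Defs where

open import Data.Nat using (ℕ; zero; suc; _+_; _*_; _≤_; _<_)
open import Data.Fin using (Fin; zero; suc; _≟_)
open import Data.Bool using (Bool; true; false; if_then_else_)
open import Data.Maybe using (Maybe; just; nothing)
open import Data.List using (allFin; foldr)
open import Data.Bool using (_∧_)
open import Data.Product using (Σ; _×_; ∃)
open import Data.Empty using (⊥)
open import Relation.Nullary using (¬_; Dec; yes; no)
open import Relation.Nullary.Decidable using (⌊_⌋)
open import Relation.Binary.PropositionalEquality using (_≡_; _≢_)

record Graph : Set where
  field
    N   : ℕ
    Adj : Fin N → Fin N → Bool
open Graph public

-- The star K_{1,r}: vertex zero is the centre, vertices suc i are the r leaves.
starAdj : (r : ℕ) → Fin (suc r) → Fin (suc r) → Bool
starAdj r zero    zero    = false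
starAdj r zero    (suc _) = true
starAdj r (suc _) zero    = true
starAdj r (suc _) (suc _) = false

Star : ℕ → Graph
Star r = record { N = suc r ; Adj = starAdj r }

data Player : Set where
  alice bob : Player

other : Player → Player
other alice = bob
other bob   = alice

record Position (G : Graph) : Set where
  constructor pos
  field
    col    : Fin (N G) → Maybe ℕ   -- nothing = still uncoloured (first round only)
    chosen : Fin (N G) → Bool      -- already chosen in the current round
    turn   : Player
open Position public

initPos : (G : Graph) → Position G
initPos G = pos (λ _ → nothing) (λ _ → false) alice

allTrue : {n : ℕ} → (Fin n → Bool) → Bool
allTrue {n} f = foldr (λ u b → f u ∧ b) true (allFin n)

update : {n : ℕ} {A : Set} → (Fin n → A) → Fin n → A → Fin n → A
update f v x u = if ⌊ u ≟ v ⌋ then x else f u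

-- Colour c ∈ {1,…,k} is legal for vertex v: it differs from v's current
-- colour (vacuous in the first round, when v is uncoloured) and from the
-- current colour of every neighbour of v (so the (partial) colouring stays proper).
Legal : (G : Graph) (k : ℕ) → Position G → Fin (N G) → ℕ → Set
Legal G k p v c =
  (1 ≤ c) × (c ≤ k) × (col p v ≢ just c) ×
  ((u : Fin (N G)) → Adj G v u ≡ true → col p u ≢ just c)

Smallest : (G : Graph) (k : ℕ) → Position G → Fin (N G) → ℕ → Set
Smallest G k p v c = Legal G k p v c × ((c' : ℕ) → c' < c → ¬ Legal G k p v c')

Available : (G : Graph) → Position G → Fin (N G) → Set
Available G p v = chosen p v ≡ false

move : (G : Graph) → Position G → Fin (N G) → ℕ → Position G
move G p v c =
  let ch = update (chosen p) v true in
  pos (update (col p) v (just c))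
      (if allTrue ch then (λ _ → false) else ch)
      (other (turn p))

-- Alice has a winning strategy (the game goes on forever) iff there is a
-- set S of positions containing the initial one that Alice can keep the
-- play inside: at her turn she has a (legal) move staying in S, and at
-- Bob's turn every vertex Bob may choose has a legal colour and every
-- move Bob is allowed to make stays in S.

AliceConstraint : Bool → (G : Graph) (k : ℕ) → Position G → Fin (N G) → ℕ → Set
AliceConstraint true  G k p v c = Smallest G k p v c
AliceConstraint false G k p v c = Legal G k p v c

AliceWins : (aliceGreedy : Bool) (G : Graph) (k : ℕ) → Set₁
AliceWins ag G k =
  Σ (Position G → Set) λ S →
    S (initPos G) ×
    ((p : Position G) → S p → turn p ≡ alice →
       Σ (Fin (N G)) λ v → Σ ℕ λ c →
         Available G p v × AliceConstraint ag G k p v c × S (move G p v c)) ×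
    ((p : Position G) → S p → turn p ≡ bob →
       (v : Fin (N G)) → Available G p v →
         (Σ ℕ λ c → Legal G k p v c) ×
         ((c : ℕ) → Smallest G k p v c → S (move G p v c)))

-- χ_g^{∞2}: only Bob greedy;  χ_g^{∞3}: both greedy.
AliceWins2 AliceWins3 : Graph → ℕ → Set₁
AliceWins2 = AliceWins false
AliceWins3 = AliceWins true

IsChi : (Graph → ℕ → Set₁) → Graph → ℕ → Set₁
IsChi W G m = W G m × ((k : ℕ) → k < m → ¬ W G k)

-- With at most two colours, after the first round every vertex sees two distinct colours
-- (its own and a neighbour's), so no vertex can be recoloured and Bob wins.
--
-- With three colours on K_{1,2n+1}, which has an even number of vertices, Alice opens every
-- round and recolours the centre first: with 1 in round one, later with the unique colour
-- avoiding the centre's colour b and the leaves' common colour a.  A leaf must then avoid a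
-- and the centre's new colour, so it receives b (in round one the least colour other than 1);
-- each round permutes the three colours and the play never ends, even though Alice, too,
-- has to play greedily.
--
-- With three colours on K_{1,2n}, which has an odd number of vertices, Bob opens round two.
-- If the centre can be recoloured at all, all leaves share one colour a; Bob recolours one
-- leaf to the third colour.  With at least three leaves, after Alice's reply some leaf still
-- has colour a, so the centre, still to be chosen in this round, sees all three colours.

module Submission where

open import Defs
open import Data.Nat using (ℕ; zero; suc; _+_; _*_; _≤_; _<_; z≤n; s≤s; _≤?_)
import Data.Nat.Properties as ℕ
open import Data.Nat.Properties using (≤-trans; m≤n⇒m≤1+n; <-irrefl; <⇒≢; <-cmp; m<m+n; +-suc; +-comm; *-suc; anyUpTo?; m≤n⇒m<n∨m≡n; m≤n+m; ≤-pred; *-monoʳ-≤)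
open import Data.Nat.Induction using (<-rec)
open import Data.Fin using (Fin; zero; suc; _≟_; punchIn)
open import Data.Fin.Properties using (all?; ¬∀⟶∃¬; punchInᵢ≢i; suc-injective)
open import Data.Bool using (Bool; true; false; _∧_; if_then_else_)
import Data.Bool.Properties as Bool
open import Data.Maybe using (Maybe; just; nothing)
open import Data.Maybe.Properties using (≡-dec; just-injective)
open import Data.List using ([]; _∷_; foldr; allFin)
open import Data.List.Relation.Unary.All as All using (All; []; _∷_)
open import Data.List.Membership.Propositional.Properties using (∈-allFin)
open import Data.Product using (Σ; ∃; _×_; _,_; proj₁; proj₂; map₂)
open import Data.Sum using (_⊎_; inj₁; inj₂)
open import Data.Empty using (⊥)
open import Function using (_∘_)
open import Relation.Nullary using (¬_; Dec; yes; no; contradiction)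
open import Relation.Nullary.Decidable using (_×-dec_; _→-dec_; ¬?)
open import Relation.Unary using (Decidable)
open import Relation.Binary.Definitions using (tri<; tri≈; tri>)
open import Relation.Binary.PropositionalEquality using (_≡_; _≢_; refl; sym; trans; cong; subst)

update-other : ∀ {n} {A : Set} (f : Fin n → A) {v} x {u} → u ≢ v → update f v x u ≡ f u
update-other f {v} x {u} u≢v with u ≟ v
... | yes u≡v = contradiction u≡v u≢v
... | no _ = refl

update-suc : ∀ {n} {A : Set} (f : Fin (suc n) → A) v x u →
             update f (suc v) x (suc u) ≡ update (f ∘ suc) v x u
update-suc f v x u with u ≟ v
... | yes _ = refl
... | no _ = refl

foldr-∧⇒All : ∀ {A : Set} (f : A → Bool) xs →
              foldr (λ u b → f u ∧ b) true xs ≡ true → All (λ u → f u ≡ true) xs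
foldr-∧⇒All f [] _ = []
foldr-∧⇒All f (x ∷ xs) holds with f x in fx
... | true = fx ∷ foldr-∧⇒All f xs holds

All⇒foldr-∧ : ∀ {A : Set} {f : A → Bool} {xs} →
              All (λ u → f u ≡ true) xs → foldr (λ u b → f u ∧ b) true xs ≡ true
All⇒foldr-∧ [] = refl
All⇒foldr-∧ (fx ∷ fxs) rewrite fx = All⇒foldr-∧ fxs

allTrue⇒all : ∀ {n} (f : Fin n → Bool) → allTrue f ≡ true → ∀ i → f i ≡ true
allTrue⇒all {n} f holds i = All.lookup (foldr-∧⇒All f (allFin n) holds) (∈-allFin i)

all⇒allTrue : ∀ {n} (f : Fin n → Bool) → (∀ i → f i ≡ true) → allTrue f ≡ true
all⇒allTrue {n} f all = All⇒foldr-∧ (All.universal all (allFin n))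

false⇒allTrue≡false : ∀ {n} (f : Fin n → Bool) i → f i ≡ false → allTrue f ≡ false
false⇒allTrue≡false f i fi≡false with allTrue f in holds
... | false = refl
... | true = contradiction (trans (sym fi≡false) (allTrue⇒all f holds i)) λ ()

¬all⇒∃false : ∀ {n} (f : Fin n → Bool) → ¬ (∀ i → f i ≡ true) → ∃ λ i → f i ≡ false
¬all⇒∃false {n} f ¬all =
  map₂ Bool.¬-not (¬∀⟶∃¬ n (λ i → f i ≡ true) (λ i → f i Bool.≟ true) ¬all)

allTrue≡false⇒∃false : ∀ {n} (f : Fin n → Bool) → allTrue f ≡ false → ∃ λ i → f i ≡ false
allTrue≡false⇒∃false f fails =
  ¬all⇒∃false f λ all → contradiction (trans (sym fails) (all⇒allTrue f all)) λ ()

count : ∀ {n} → (Fin n → Bool) → ℕ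
count {zero} f = 0
count {suc n} f = if f zero then suc (count (f ∘ suc)) else count (f ∘ suc)

count-cong : ∀ {n} {f g : Fin n → Bool} → (∀ i → f i ≡ g i) → count f ≡ count g
count-cong {zero} f≗g = refl
count-cong {suc n} {f} {g} f≗g rewrite f≗g zero | count-cong {f = f ∘ suc} {g ∘ suc} (f≗g ∘ suc) = refl

count-none : ∀ {n} (f : Fin n → Bool) → (∀ i → f i ≡ false) → count f ≡ 0
count-none {zero} f none = refl
count-none {suc n} f none rewrite none zero = count-none (f ∘ suc) (none ∘ suc)

count-all : ∀ {n} (f : Fin n → Bool) → (∀ i → f i ≡ true) → count f ≡ n
count-all {zero} f all = refl
count-all {suc n} f all rewrite all zero = cong suc (count-all (f ∘ suc) (all ∘ suc))

count-≤ : ∀ {n} (f : Fin n → Bool) → count f ≤ n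
count-≤ {zero} f = z≤n
count-≤ {suc n} f with f zero
... | true = s≤s (count-≤ (f ∘ suc))
... | false = m≤n⇒m≤1+n (count-≤ (f ∘ suc))

count≡n⇒all : ∀ {n} (f : Fin n → Bool) → count f ≡ n → ∀ i → f i ≡ true
count≡n⇒all {suc n} f full i with f zero in f0
count≡n⇒all {suc n} f full zero | true = f0
count≡n⇒all {suc n} f full (suc i) | true = count≡n⇒all (f ∘ suc) (ℕ.suc-injective full) i
... | false = contradiction full (<⇒≢ (s≤s (count-≤ (f ∘ suc))))

count<n⇒∃false : ∀ {n} (f : Fin n → Bool) → count f < n → ∃ λ i → f i ≡ false
count<n⇒∃false f count<n = ¬all⇒∃false f λ all → <-irrefl (count-all f all) count<n

count-update : ∀ {n} (f : Fin n → Bool) v → f v ≡ false → count (update f v true) ≡ suc (count f)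
count-update {suc n} f zero fv rewrite fv = refl
count-update {suc n} f (suc v) fv with f zero
... | true = cong suc (trans (count-cong (update-suc f v true)) (count-update (f ∘ suc) v fv))
... | false = trans (count-cong (update-suc f v true)) (count-update (f ∘ suc) v fv)

parity : ℕ → Player
parity zero = alice
parity (suc m) = other (parity m)

other-involutive : ∀ t → other (other t) ≡ t
other-involutive alice = refl
other-involutive bob = refl

parity-even : ∀ n → parity (2 * n) ≡ alice
parity-even zero = refl
parity-even (suc n) = trans (cong parity (*-suc 2 n)) (trans (other-involutive _) (parity-even n))

parity-odd : ∀ n → parity (suc (2 * n)) ≡ bob
parity-odd n = cong other (parity-even n)

data Colour₃ : ℕ → Set where
  one : Colour₃ 1
  two : Colour₃ 2
  three : Colour₃ 3

colour₃ : ∀ {x} → 1 ≤ x → x ≤ 3 → Colour₃ x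
colour₃ {1} _ _ = one
colour₃ {2} _ _ = two
colour₃ {3} _ _ = three
colour₃ {suc (suc (suc (suc _)))} _ (s≤s (s≤s (s≤s ())))

Colour₃-bounds : ∀ {x} → Colour₃ x → 1 ≤ x × x ≤ 3
Colour₃-bounds one = s≤s z≤n , s≤s z≤n
Colour₃-bounds two = s≤s z≤n , s≤s (s≤s z≤n)
Colour₃-bounds three = s≤s z≤n , s≤s (s≤s (s≤s z≤n))

data AllThree : ℕ → ℕ → ℕ → Set where
  c123 : AllThree 1 2 3
  c132 : AllThree 1 3 2
  c213 : AllThree 2 1 3
  c231 : AllThree 2 3 1
  c312 : AllThree 3 1 2
  c321 : AllThree 3 2 1

AllThree-swap₂₃ : ∀ {a b c} → AllThree a b c → AllThree a c b
AllThree-swap₂₃ c123 = c132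
AllThree-swap₂₃ c132 = c123
AllThree-swap₂₃ c213 = c231
AllThree-swap₂₃ c231 = c213
AllThree-swap₂₃ c312 = c321
AllThree-swap₂₃ c321 = c312

AllThree-swap₁₃ : ∀ {a b c} → AllThree a b c → AllThree c b a
AllThree-swap₁₃ c123 = c321
AllThree-swap₁₃ c132 = c231
AllThree-swap₁₃ c213 = c312
AllThree-swap₁₃ c231 = c132
AllThree-swap₁₃ c312 = c213
AllThree-swap₁₃ c321 = c123

AllThree-≢₁₂ : ∀ {a b c} → AllThree a b c → a ≢ b
AllThree-≢₁₂ c123 ()
AllThree-≢₁₂ c132 ()
AllThree-≢₁₂ c213 ()
AllThree-≢₁₂ c231 ()
AllThree-≢₁₂ c312 ()
AllThree-≢₁₂ c321 ()

AllThree-≢₁₃ : ∀ {a b c} → AllThree a b c → a ≢ c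
AllThree-≢₁₃ = AllThree-≢₁₂ ∘ AllThree-swap₂₃

AllThree-≢₂₃ : ∀ {a b c} → AllThree a b c → b ≢ c
AllThree-≢₂₃ = AllThree-≢₁₂ ∘ AllThree-swap₁₃ ∘ AllThree-swap₂₃

AllThree-colour₃ : ∀ {a b c} → AllThree a b c → Colour₃ c
AllThree-colour₃ c123 = three
AllThree-colour₃ c132 = two
AllThree-colour₃ c213 = three
AllThree-colour₃ c231 = one
AllThree-colour₃ c312 = two
AllThree-colour₃ c321 = one

third-colour : ∀ {a b} → Colour₃ a → Colour₃ b → a ≢ b → ∃ (AllThree a b)
third-colour one one a≢b = contradiction refl a≢b
third-colour one two _ = 3 , c123
third-colour one three _ = 2 , c132
third-colour two one _ = 3 , c213
third-colour two two a≢b = contradiction refl a≢b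
third-colour two three _ = 1 , c231
third-colour three one _ = 2 , c312
third-colour three two _ = 1 , c321
third-colour three three a≢b = contradiction refl a≢b

AllThree-unique : ∀ {a b c x} → AllThree a b c → Colour₃ x → x ≢ a → x ≢ b → x ≡ c
AllThree-unique c123 three _ _ = refl
AllThree-unique c132 two _ _ = refl
AllThree-unique c213 three _ _ = refl
AllThree-unique c231 one _ _ = refl
AllThree-unique c312 two _ _ = refl
AllThree-unique c321 one _ _ = refl
AllThree-unique c123 one x≢a _ = contradiction refl x≢a
AllThree-unique c123 two _ x≢b = contradiction refl x≢b
AllThree-unique c132 one x≢a _ = contradiction refl x≢a
AllThree-unique c132 three _ x≢b = contradiction refl x≢b
AllThree-unique c213 two x≢a _ = contradiction refl x≢a
AllThree-unique c213 one _ x≢b = contradiction refl x≢b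
AllThree-unique c231 two x≢a _ = contradiction refl x≢a
AllThree-unique c231 three _ x≢b = contradiction refl x≢b
AllThree-unique c312 three x≢a _ = contradiction refl x≢a
AllThree-unique c312 one _ x≢b = contradiction refl x≢b
AllThree-unique c321 three x≢a _ = contradiction refl x≢a
AllThree-unique c321 two _ x≢b = contradiction refl x≢b

no-four-distinct-colours : ∀ {w x y z} → Colour₃ w → Colour₃ x → Colour₃ y → Colour₃ z →
  w ≢ x → w ≢ y → w ≢ z → x ≢ y → x ≢ z → y ≢ z → ⊥
no-four-distinct-colours w x y z w≢x w≢y w≢z x≢y x≢z y≢z =
  let (_ , t) = third-colour w x w≢x
  in y≢z (trans (AllThree-unique t y (w≢y ∘ sym) (x≢y ∘ sym))
                (sym (AllThree-unique t z (w≢z ∘ sym) (x≢z ∘ sym))))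

no-three-distinct-colours₂ : ∀ {x y z} → 1 ≤ x → x ≤ 2 → 1 ≤ y → y ≤ 2 → 1 ≤ z → z ≤ 2 →
                             x ≢ y → x ≢ z → y ≢ z → ⊥
no-three-distinct-colours₂ 1≤x x≤2 1≤y y≤2 1≤z z≤2 =
  no-four-distinct-colours three
    (colour₃ 1≤x (m≤n⇒m≤1+n x≤2)) (colour₃ 1≤y (m≤n⇒m≤1+n y≤2)) (colour₃ 1≤z (m≤n⇒m≤1+n z≤2))
    (<⇒≢ (s≤s x≤2) ∘ sym) (<⇒≢ (s≤s y≤2) ∘ sym) (<⇒≢ (s≤s z≤2) ∘ sym)

just-≢ : ∀ {A : Set} {m : Maybe A} {x y} → m ≡ just x → m ≢ just y → x ≢ y
just-≢ m≡x m≢y x≡y = m≢y (trans m≡x (cong just x≡y))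

≢-just : ∀ {A : Set} {m : Maybe A} {x y} → m ≡ just x → x ≢ y → m ≢ just y
≢-just m≡x x≢y m≡y = x≢y (just-injective (trans (sym m≡x) m≡y))

Least : (ℕ → Set) → ℕ → Set
Least P m = P m × (∀ j → j < m → ¬ P j)

least : ∀ {P : ℕ → Set} → Decidable P → ∀ n → P n → ∃ (Least P)
least {P} P? = <-rec _ step
  where
  step : ∀ n → (∀ {m} → m < n → P m → ∃ (Least P)) → P n → ∃ (Least P)
  step n smaller pn with anyUpTo? P? n
  ... | yes (m , m<n , pm) = smaller m<n pm
  ... | no none = n , pn , λ j j<n pj → none (j , j<n , pj)

Coloured : {G : Graph} → Position G → Fin (N G) → Set
Coloured p v = ∃ λ x → col p v ≡ just x

Marked : {G : Graph} → Position G → Fin (N G) → Fin (N G) → Bool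
Marked p v = update (chosen p) v true

TurnParity : {G : Graph} → Position G → Set
TurnParity p = turn p ≡ parity (count (chosen p))

module _ (G : Graph) where

  legal? : ∀ k p v c → Dec (Legal G k p v c)
  legal? k p v c =
    (1 ≤? c) ×-dec (c ≤? k) ×-dec ¬? (≡-dec ℕ._≟_ (col p v) (just c)) ×-dec
    all? (λ u → (Adj G v u Bool.≟ true) →-dec ¬? (≡-dec ℕ._≟_ (col p u) (just c)))

  smallest-exists : ∀ {k} p v {c} → Legal G k p v c → ∃ (Smallest G k p v)
  smallest-exists {k} p v {c} = least (legal? k p v) c

  smallest-unique : ∀ {k} p v {c c′} → Smallest G k p v c → Smallest G k p v c′ → c ≡ c′
  smallest-unique p v {c} {c′} (legal , minimal) (legal′ , minimal′) with <-cmp c c′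
  ... | tri< c<c′ _ _ = contradiction legal (minimal′ c c<c′)
  ... | tri≈ _ c≡c′ _ = c≡c′
  ... | tri> _ _ c′<c = contradiction legal′ (minimal c′ c′<c)

  unique-legal⇒smallest : ∀ {k} p v {c} → Legal G k p v c → (∀ x → Legal G k p v x → x ≡ c) →
                          Smallest G k p v c
  unique-legal⇒smallest p v legal unique = legal , λ x x<c legal-x → <-irrefl (unique x legal-x) x<c

module _ {G : Graph} where

  chosen-move-ongoing : ∀ p v c → allTrue (Marked p v) ≡ false → chosen (move G p v c) ≡ Marked p v
  chosen-move-ongoing p v c ongoing rewrite ongoing = refl

  chosen-move-ends : ∀ p v c → allTrue (Marked p v) ≡ true → ∀ u → Available G (move G p v c) u
  chosen-move-ends p v c ends u rewrite ends = refl

  available-move : ∀ p {u v} c → Available G p u → u ≢ v → Available G (move G p v c) u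
  available-move p {u} {v} c available u≢v with allTrue (Marked p v)
  ... | true = refl
  ... | false = trans (update-other (chosen p) true u≢v) available

  turnParity-ongoing : ∀ p {v} c → Available G p v → allTrue (Marked p v) ≡ false →
                       TurnParity p → TurnParity (move G p v c)
  turnParity-ongoing p {v} c available ongoing parity-p =
    trans (cong other parity-p)
          (cong parity (sym (trans (cong count (chosen-move-ongoing p v c ongoing)) (count-update (chosen p) v available))))

  turnParity-ends : ∀ p {v} c → Available G p v → allTrue (Marked p v) ≡ true →
                    TurnParity p → turn (move G p v c) ≡ parity (N G)
  turnParity-ends p {v} c available ends parity-p =
    trans (cong other parity-p)
          (cong parity (trans (sym (count-update (chosen p) v available)) (count-all (Marked p v) (allTrue⇒all _ ends))))

  marked⇒coloured : ∀ p v c → (∀ u → chosen p u ≡ true → Coloured p u) →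
                    ∀ u → Marked p v u ≡ true → Coloured (move G p v c) u
  marked⇒coloured p v c chosen⇒coloured u marked with u ≟ v
  ... | yes _ = c , refl
  ... | no _ = chosen⇒coloured u marked

greedy-win⇒win : ∀ {G k} → AliceWins true G k → AliceWins false G k
greedy-win⇒win {G} {k} (S , S-init , aliceStep , bobStep) =
  S , S-init , nonGreedy , bobStep
  where
  nonGreedy : ∀ p → S p → turn p ≡ alice →
              Σ (Fin (N G)) λ v → Σ ℕ λ c → Available G p v × Legal G k p v c × S (move G p v c)
  nonGreedy p sp alice-moves =
    let (v , c , available , greedy , next) = aliceStep p sp alice-moves in v , c , available , proj₁ greedy , next

-- The first round of play

module Play {G : Graph} {k : ℕ} (W : AliceWins false G k) where

  S : Position G → Set
  S = proj₁ W

  S-init : S (initPos G)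
  S-init = proj₁ (proj₂ W)

  aliceStep : ∀ p → S p → turn p ≡ alice →
              Σ (Fin (N G)) λ v → Σ ℕ λ c → Available G p v × Legal G k p v c × S (move G p v c)
  aliceStep = proj₁ (proj₂ (proj₂ W))

  bobStep : ∀ p → S p → turn p ≡ bob → ∀ v → Available G p v →
            (∃ (Legal G k p v)) × (∀ c → Smallest G k p v c → S (move G p v c))
  bobStep = proj₂ (proj₂ (proj₂ W))

  record Step (p : Position G) : Set where
    constructor step
    field
      vertex : Fin (N G)
      colour : ℕ
      available : Available G p vertex
      legal : Legal G k p vertex colour
      next : S (move G p vertex colour)

  someMove : ∀ {p u} → S p → Available G p u → Step p
  someMove {p} {u} sp available = byTurn (turn p) refl
    where
    byTurn : ∀ t → turn p ≡ t → Step p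
    byTurn alice alice-moves =
      let (v , c , av , legal , next) = aliceStep p sp alice-moves in step v c av legal next
    byTurn bob bob-moves =
      let (legal , stays) = bobStep p sp bob-moves u available
          (c , greedy) = smallest-exists G p u (proj₂ legal)
      in step u c available (proj₁ greedy) (stays c greedy)

  stuck∉S : ∀ {p u} → S p → Available G p u → (∀ v c → ¬ Legal G k p v c) → ⊥
  stuck∉S sp available stuck = let step v c _ legal _ = someMove sp available in stuck v c legal

  record EndOfFirstRound (I : Position G → Set) : Set where
    field
      position : Position G
      reached : S position
      invariant : I position
      coloured : ∀ v → Coloured position v
      fresh : ∀ v → Available G position v
      nextTurn : turn position ≡ parity (N G)

  module _ (I : Position G → Set) (I-move : ∀ {p v c} → I p → Legal G k p v c → I (move G p v c)) where

    record InFirstRound (p : Position G) : Set where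
      field
        inS : S p
        inv : I p
        chosen⇒coloured : ∀ u → chosen p u ≡ true → Coloured p u
        turnParity : TurnParity p
    open InFirstRound

    playFirstRound : ∀ d p → InFirstRound p → count (chosen p) + suc d ≡ N G → EndOfFirstRound I
    afterMove : ∀ d p → InFirstRound p → count (chosen p) + suc d ≡ N G → (s : Step p) →
                ∀ b → allTrue (Marked p (Step.vertex s)) ≡ b → EndOfFirstRound I

    playFirstRound d p now remaining = afterMove d p now remaining s (allTrue (Marked p (Step.vertex s))) refl
      where
      s : Step p
      s = someMove (inS now)
            (proj₂ (count<n⇒∃false (chosen p) (subst (count (chosen p) <_) remaining (m<m+n _ (s≤s z≤n)))))

    afterMove d p now remaining (step v c available legal next) true ends = record
      { position = move G p v c
      ; reached = next
      ; invariant = I-move (inv now) legal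
      ; coloured = λ u → marked⇒coloured p v c (chosen⇒coloured now) u (allTrue⇒all _ ends u)
      ; fresh = chosen-move-ends p v c ends
      ; nextTurn = turnParity-ends p c available ends (turnParity now)
      }
    afterMove zero p now remaining (step v c available legal next) false ends =
      contradiction (trans (sym ends) (all⇒allTrue _ (count≡n⇒all (Marked p v) counted-all))) λ ()
      where
      counted-all : count (Marked p v) ≡ N G
      counted-all = trans (count-update (chosen p) v available) (trans (+-comm 1 _) remaining)
    afterMove (suc d) p now remaining (step v c available legal next) false ends =
      playFirstRound d (move G p v c) record
        { inS = next
        ; inv = I-move (inv now) legal
        ; chosen⇒coloured = λ u ch → marked⇒coloured p v c (chosen⇒coloured now) u
                                       (trans (cong (λ f → f u) (sym (chosen-move-ongoing p v c ends))) ch)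
        ; turnParity = turnParity-ongoing p c available ends (turnParity now)
        } (trans (cong (_+ suc d) counted) (trans (sym (+-suc _ (suc d))) remaining))
      where
      counted : count (chosen (move G p v c)) ≡ suc (count (chosen p))
      counted = trans (cong count (chosen-move-ongoing p v c ends)) (count-update (chosen p) v available)

    firstRound : I (initPos G) → ∀ {m} → N G ≡ suc m → EndOfFirstRound I
    firstRound I-init {m} size = playFirstRound m (initPos G) record
      { inS = S-init
      ; inv = I-init
      ; chosen⇒coloured = λ u ()
      ; turnParity = cong parity (sym (count-none {N G} _ λ _ → refl))
      } (trans (cong (_+ suc m) (count-none {N G} _ λ _ → refl)) (sym size))

-- Proper colourings of stars

ProperStar : ∀ {r} → Position (Star r) → Set
ProperStar p = ∀ i x → col p zero ≡ just x → col p (suc i) ≢ just x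

WithinPalette : ∀ {G} → ℕ → Position G → Set
WithinPalette k p = ∀ v x → col p v ≡ just x → 1 ≤ x × x ≤ k

ProperColouring : ∀ {r} → ℕ → Position (Star r) → Set
ProperColouring k p = ProperStar p × WithinPalette k p

legal-preserves-ProperStar : ∀ {r k} p v {c} → ProperStar p → Legal (Star r) k p v c →
                             ProperStar (move (Star r) p v c)
legal-preserves-ProperStar p zero proper (_ , _ , _ , nbrs) i x refl = nbrs (suc i) refl
legal-preserves-ProperStar p (suc j) proper (_ , _ , _ , nbrs) i x centre with suc i ≟ suc j
... | yes _ = λ c≡x → nbrs zero refl (trans centre (sym c≡x))
... | no _ = proper i x centre

legal-preserves-WithinPalette : ∀ {G k} p v {c} → WithinPalette k p → Legal G k p v c →
                                WithinPalette k (move G p v c)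
legal-preserves-WithinPalette p v palette (1≤c , c≤k , _) u x coloured with u ≟ v
legal-preserves-WithinPalette p v palette (1≤c , c≤k , _) u x refl | yes _ = 1≤c , c≤k
... | no _ = palette u x coloured

firstRoundOnStar : ∀ {r k} (W : AliceWins false (Star r) k) → Play.EndOfFirstRound W (ProperColouring k)
firstRoundOnStar {r} {k} W = firstRound (ProperColouring k) (λ {p} {v} → preserved p v) ((λ _ _ ()) , (λ _ _ ())) refl
  where
  open Play W
  preserved : ∀ p v {c} → ProperColouring k p → Legal (Star r) k p v c → ProperColouring k (move (Star r) p v c)
  preserved p v (proper , palette) legal =
    legal-preserves-ProperStar p v proper legal , legal-preserves-WithinPalette p v palette legal

leaf-legal : ∀ {r k} (p : Position (Star r)) i {x} → 1 ≤ x → x ≤ k →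
             col p (suc i) ≢ just x → col p zero ≢ just x → Legal (Star r) k p (suc i) x
leaf-legal p i 1≤x x≤k own centre = 1≤x , x≤k , own , λ { zero _ → centre ; (suc _) () }

centre-legal : ∀ {r k} (p : Position (Star r)) {x} → 1 ≤ x → x ≤ k →
               col p zero ≢ just x → (∀ i → col p (suc i) ≢ just x) → Legal (Star r) k p zero x
centre-legal p 1≤x x≤k own leaves = 1≤x , x≤k , own , λ { zero () ; (suc i) _ → leaves i }

ProperStar⇒≢ : ∀ {r b a} (p : Position (Star r)) {i} → ProperStar p →
               col p zero ≡ just b → col p (suc i) ≡ just a → b ≢ a
ProperStar⇒≢ p {i} proper centre leaf b≡a = proper i _ centre (trans leaf (cong just (sym b≡a)))

centre-blocked : ∀ {r b x y c} (p : Position (Star r)) i j → Colour₃ b → Colour₃ x → Colour₃ y →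
                 b ≢ x → b ≢ y → x ≢ y → col p zero ≡ just b → col p (suc i) ≡ just x → col p (suc j) ≡ just y →
                 ¬ Legal (Star r) 3 p zero c
centre-blocked p i j B X Y b≢x b≢y x≢y centre leaf-i leaf-j (1≤c , c≤3 , own , nbrs) =
  no-four-distinct-colours B X Y (colour₃ 1≤c c≤3) b≢x b≢y (just-≢ centre own) x≢y
    (just-≢ leaf-i (nbrs (suc i) refl)) (just-≢ leaf-j (nbrs (suc j) refl))

centre-legal⇒leaves-agree : ∀ {r b x y c} (p : Position (Star r)) i j → Colour₃ b → Colour₃ x → Colour₃ y →
                            b ≢ x → b ≢ y →
                            col p zero ≡ just b → col p (suc i) ≡ just x → col p (suc j) ≡ just y →
                            Legal (Star r) 3 p zero c → x ≡ y
centre-legal⇒leaves-agree {x = x} {y} p i j B X Y b≢x b≢y centre leaf-i leaf-j legal with x ℕ.≟ y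
... | yes x≡y = x≡y
... | no x≢y = contradiction legal (centre-blocked p i j B X Y b≢x b≢y x≢y centre leaf-i leaf-j)

two-colours-blocked : ∀ {G k x y c} (p : Position G) {u w} → k ≤ 2 → WithinPalette k p →
                      col p u ≡ just x → col p w ≡ just y → x ≢ y →
                      1 ≤ c → c ≤ k → col p u ≢ just c → col p w ≢ just c → ⊥
two-colours-blocked p {u} {w} k≤2 palette colour-u colour-w x≢y 1≤c c≤k u≢c w≢c =
  let (1≤x , x≤k) = palette u _ colour-u
      (1≤y , y≤k) = palette w _ colour-w
  in no-three-distinct-colours₂ 1≤x (≤-trans x≤k k≤2) 1≤y (≤-trans y≤k k≤2) 1≤c (≤-trans c≤k k≤2)
       x≢y (just-≢ colour-u u≢c) (just-≢ colour-w w≢c)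

two-colours-stuck : ∀ {r k} (p : Position (Star (suc r))) → k ≤ 2 → ProperColouring k p →
                    (∀ v → Coloured p v) → ∀ v c → ¬ Legal (Star (suc r)) k p v c
two-colours-stuck p k≤2 (proper , palette) coloured zero c (1≤c , c≤k , own , nbrs) =
  two-colours-blocked p k≤2 palette (proj₂ (coloured zero)) (proj₂ (coloured (suc zero)))
    (ProperStar⇒≢ p proper (proj₂ (coloured zero)) (proj₂ (coloured (suc zero))))
    1≤c c≤k own (nbrs (suc zero) refl)
two-colours-stuck p k≤2 (proper , palette) coloured (suc i) c (1≤c , c≤k , own , nbrs) =
  two-colours-blocked p k≤2 palette (proj₂ (coloured (suc i))) (proj₂ (coloured zero))
    (ProperStar⇒≢ p proper (proj₂ (coloured zero)) (proj₂ (coloured (suc i))) ∘ sym)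
    1≤c c≤k own (nbrs zero refl)

fewer-than-three-colours-lose : ∀ r k → 1 ≤ r → k ≤ 2 → ¬ AliceWins false (Star r) k
fewer-than-three-colours-lose (suc r) k _ k≤2 W =
  stuck∉S reached (fresh zero) (two-colours-stuck position k≤2 invariant coloured)
  where
  open Play W
  open EndOfFirstRound (firstRoundOnStar W)

-- Three colours on a star of odd order

module BobOpensRoundTwo {r} (W : AliceWins false (Star (suc (suc (suc r)))) 3)
                        (end : Play.EndOfFirstRound W (ProperColouring 3)) where
  open Play W
  open EndOfFirstRound end renaming (position to q)

  G : Graph
  G = Star (suc (suc (suc r)))

  colour-of : ∀ v → Colour₃ (proj₁ (coloured v))
  colour-of v = let (1≤x , x≤3) = proj₂ invariant v _ (proj₂ (coloured v)) in colour₃ 1≤x x≤3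

  b a : ℕ
  b = proj₁ (coloured zero)
  a = proj₁ (coloured (suc zero))

  centre : col q zero ≡ just b
  centre = proj₂ (coloured zero)

  leaf₀ : col q (suc zero) ≡ just a
  leaf₀ = proj₂ (coloured (suc zero))

  b≢a : b ≢ a
  b≢a = ProperStar⇒≢ q (proj₁ invariant) centre leaf₀

  module _ (bob-to-move : turn q ≡ bob) where

    leaves : ∀ i → col q (suc i) ≡ just a
    leaves i = trans leafᵢ (cong just (sym (centre-legal⇒leaves-agree q zero i
                 (colour-of zero) (colour-of (suc zero)) (colour-of (suc i))
                 b≢a (ProperStar⇒≢ q (proj₁ invariant) centre leafᵢ) centre leaf₀ leafᵢ centre-recolourable)))
      where
      leafᵢ : col q (suc i) ≡ just (proj₁ (coloured (suc i)))
      leafᵢ = proj₂ (coloured (suc i))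
      centre-recolourable : Legal G 3 q zero _
      centre-recolourable = proj₂ (proj₁ (bobStep q reached bob-to-move zero (fresh zero)))

    module _ {c₁} (greedy : Smallest G 3 q (suc zero) c₁) where

      p₁ : Position G
      p₁ = move G q (suc zero) c₁

      s₁ : S p₁
      s₁ = proj₂ (bobStep q reached bob-to-move (suc zero) (fresh (suc zero))) c₁ greedy

      blocked : ∀ (p : Position G) i {c} → col p zero ≡ just b → col p (suc i) ≡ just a →
                col p (suc zero) ≡ just c₁ → ¬ Legal G 3 p zero c
      blocked p i with proj₁ greedy
      ... | (1≤c₁ , c₁≤3 , own , nbrs) =
        centre-blocked p i zero (colour-of zero) (colour-of (suc zero)) (colour₃ 1≤c₁ c₁≤3)
          b≢a (just-≢ centre (nbrs zero refl)) (just-≢ leaf₀ own)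

      alice-replies : ∀ w {c} → Available G p₁ w → Legal G 3 p₁ w c → S (move G p₁ w c) → ⊥
      alice-replies zero _ legal _ = blocked p₁ (suc zero) centre (leaves (suc zero)) refl legal
      alice-replies (suc zero) available _ _ =
        contradiction (trans (sym available) (cong (λ f → f (suc zero)) (chosen-move-ongoing q (suc zero) c₁ ongoing)))
                      λ ()
        where
        ongoing : allTrue (Marked q (suc zero)) ≡ false
        ongoing = false⇒allTrue≡false (Marked q (suc zero)) zero (fresh zero)
      alice-replies (suc (suc j)) {c} _ _ next =
        blocked p₂ (suc m) centre (trans (update-other (col p₁) (just c) m≢j) (leaves (suc m))) refl
          (proj₂ (proj₁ (bobStep p₂ next (cong (other ∘ other) bob-to-move) zero centre-available)))
        where
        p₂ : Position G
        p₂ = move G p₁ (suc (suc j)) c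
        m : Fin (suc (suc r))
        m = punchIn j zero
        m≢j : suc (suc m) ≢ suc (suc j)
        m≢j = punchInᵢ≢i j zero ∘ suc-injective ∘ suc-injective
        centre-available : Available G p₂ zero
        centre-available =
          available-move p₁ {zero} {suc (suc j)} c (available-move q {zero} {suc zero} c₁ (fresh zero) λ ()) λ ()

      alice-stuck : ⊥
      alice-stuck = let (w , c , available , legal , next) = aliceStep p₁ s₁ (cong other bob-to-move)
                    in alice-replies w available legal next

    bob-wins : ⊥
    bob-wins = alice-stuck (proj₂ (smallest-exists G q (suc zero) leaf₀-recolourable))
      where
      leaf₀-recolourable : Legal G 3 q (suc zero) _
      leaf₀-recolourable = proj₂ (proj₁ (bobStep q reached bob-to-move (suc zero) (fresh (suc zero))))

three-colours-lose-if-bob-opens-round-two : ∀ r → 3 ≤ r → parity (suc r) ≡ bob → ¬ AliceWins false (Star r) 3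
three-colours-lose-if-bob-opens-round-two (suc (suc (suc r))) _ bob-opens W =
  BobOpensRoundTwo.bob-wins W end (trans (EndOfFirstRound.nextTurn end) bob-opens)
  where
  open Play W using (EndOfFirstRound)
  end : EndOfFirstRound (ProperColouring 3)
  end = firstRoundOnStar W
three-colours-lose-if-bob-opens-round-two (suc (suc zero)) (s≤s (s≤s ())) _

-- Three colours on a star of even order

module CentreFirst (r : ℕ) (alice-opens : parity (suc (suc r)) ≡ alice) where

  G : Graph
  G = Star (suc r)

  record Phase (o : Maybe ℕ) (c a′ : ℕ) (p : Position G) : Set where
    field
      centreChosen : chosen p zero ≡ true
      centreColour : col p zero ≡ just c
      chosenLeaf : ∀ i → chosen p (suc i) ≡ true → col p (suc i) ≡ just a′
      unchosenLeaf : ∀ i → chosen p (suc i) ≡ false → col p (suc i) ≡ o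
      turnParity : TurnParity p
      roundOngoing : allTrue (chosen p) ≡ false
  open Phase

  record RoundStart (b a : ℕ) (p : Position G) : Set where
    field
      aliceToMove : turn p ≡ alice
      unchosen : ∀ v → chosen p v ≡ false
      centreColour : col p zero ≡ just b
      leafColour : ∀ i → col p (suc i) ≡ just a
  open RoundStart

  -- In a round whose unchosen leaves still have colour o and whose centre has been recoloured
  -- to c, every greedy player gives a leaf the colour a′.
  data LeafRule : Maybe ℕ → ℕ → ℕ → Set where
    firstRound : LeafRule nothing 1 2
    laterRound : ∀ {a c a′} → AllThree a c a′ → LeafRule (just a) c a′

  data Reachable : Position G → Set where
    initial : Reachable (initPos G)
    roundStart : ∀ {a b c p} → AllThree a b c → RoundStart b a p → Reachable p
    midRound : ∀ {o c a′ p} → LeafRule o c a′ → Phase o c a′ p → Reachable p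

  centreMove : ∀ {o p} x a′ → (∀ v → chosen p v ≡ false) → turn p ≡ alice →
               (∀ i → col p (suc i) ≡ o) → Phase o x a′ (move G p zero x)
  centreMove {o} {p} x a′ unchosen alice-moves leaves = record
    { centreChosen = chosenAt zero
    ; centreColour = refl
    ; chosenLeaf = λ j ch → contradiction (trans (sym ch) (trans (chosenAt (suc j)) (unchosen (suc j)))) λ ()
    ; unchosenLeaf = λ j _ → leaves j
    ; turnParity = turnParity-ongoing p x (unchosen zero) ongoing
                     (trans alice-moves (cong parity (sym (count-none _ unchosen))))
    ; roundOngoing = trans (cong allTrue (chosen-move-ongoing p zero x ongoing)) ongoing
    }
    where
    ongoing : allTrue (Marked p zero) ≡ false
    ongoing = false⇒allTrue≡false (Marked p zero) (suc zero) (unchosen (suc zero))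
    chosenAt : ∀ u → chosen (move G p zero x) u ≡ Marked p zero u
    chosenAt u = cong (λ f → f u) (chosen-move-ongoing p zero x ongoing)

  leafStep : ∀ {o c a′ p} i → Phase o c a′ p → chosen p (suc i) ≡ false →
             Phase o c a′ (move G p (suc i) a′) ⊎ RoundStart c a′ (move G p (suc i) a′)
  leafStep {o} {c} {a′} {p} i φ unchosen = byRoundEnd (allTrue (Marked p (suc i))) refl
    where
    q : Position G
    q = move G p (suc i) a′

    markedLeaf : ∀ j → Marked p (suc i) (suc j) ≡ true → col q (suc j) ≡ just a′
    markedLeaf j marked with suc j ≟ suc i
    ... | yes _ = refl
    ... | no _ = chosenLeaf φ j marked

    unmarkedLeaf : ∀ j → Marked p (suc i) (suc j) ≡ false → col q (suc j) ≡ o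
    unmarkedLeaf j unmarked with suc j ≟ suc i
    ... | yes _ = contradiction unmarked λ ()
    ... | no _ = unchosenLeaf φ j unmarked

    byRoundEnd : ∀ e → allTrue (Marked p (suc i)) ≡ e → Phase o c a′ q ⊎ RoundStart c a′ q
    byRoundEnd true ends = inj₂ record
      { aliceToMove = trans (turnParity-ends p a′ unchosen ends (turnParity φ)) alice-opens
      ; unchosen = chosen-move-ends p (suc i) a′ ends
      ; centreColour = centreColour φ
      ; leafColour = λ j → markedLeaf j (allTrue⇒all (Marked p (suc i)) ends (suc j))
      }
    byRoundEnd false ongoing = inj₁ record
      { centreChosen = trans (chosenAt zero) (centreChosen φ)
      ; centreColour = centreColour φ
      ; chosenLeaf = λ j ch → markedLeaf j (trans (sym (chosenAt (suc j))) ch)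
      ; unchosenLeaf = λ j unch → unmarkedLeaf j (trans (sym (chosenAt (suc j))) unch)
      ; turnParity = turnParity-ongoing p a′ unchosen ongoing (turnParity φ)
      ; roundOngoing = trans (cong allTrue (chosen-move-ongoing p (suc i) a′ ongoing)) ongoing
      }
      where
      chosenAt : ∀ u → chosen q u ≡ Marked p (suc i) u
      chosenAt u = cong (λ f → f u) (chosen-move-ongoing p (suc i) a′ ongoing)

  leaf-smallest : ∀ {o c a′ p} i → LeafRule o c a′ → Phase o c a′ p → chosen p (suc i) ≡ false →
                  Smallest G 3 p (suc i) a′
  leaf-smallest {p = p} i firstRound φ unchosen = legal , minimal
    where
    legal : Legal G 3 p (suc i) 2
    legal = leaf-legal p i (s≤s z≤n) (s≤s (s≤s z≤n))
              (λ e → contradiction (trans (sym (unchosenLeaf φ i unchosen)) e) λ ()) (≢-just (centreColour φ) λ ())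
    minimal : ∀ x → x < 2 → ¬ Legal G 3 p (suc i) x
    minimal 0 _ (() , _)
    minimal 1 _ (_ , _ , _ , nbrs) = nbrs zero refl (centreColour φ)
    minimal (suc (suc _)) (s≤s (s≤s ())) _
  leaf-smallest {a′ = a′} {p} i (laterRound t) φ unchosen = unique-legal⇒smallest G p (suc i) legal unique
    where
    leaf : col p (suc i) ≡ just _
    leaf = unchosenLeaf φ i unchosen
    legal : Legal G 3 p (suc i) a′
    legal = let (1≤a′ , a′≤3) = Colour₃-bounds (AllThree-colour₃ t)
            in leaf-legal p i 1≤a′ a′≤3 (≢-just leaf (AllThree-≢₁₃ t))
                 (≢-just (centreColour φ) (AllThree-≢₂₃ t))
    unique : ∀ x → Legal G 3 p (suc i) x → x ≡ a′
    unique x (1≤x , x≤3 , own , nbrs) =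
      AllThree-unique t (colour₃ 1≤x x≤3) (just-≢ leaf own ∘ sym)
        (just-≢ (centreColour φ) (nbrs zero refl) ∘ sym)

  nextRoundColours : ∀ {o c a′} → LeafRule o c a′ → ∃ (AllThree a′ c)
  nextRoundColours firstRound = 3 , c213
  nextRoundColours (laterRound t) = _ , AllThree-swap₁₃ t

  leafMove : ∀ {o c a′ p} i → LeafRule o c a′ → Phase o c a′ p → chosen p (suc i) ≡ false →
             Reachable (move G p (suc i) a′)
  leafMove i rule φ unchosen with leafStep i φ unchosen
  ... | inj₁ φ′ = midRound rule φ′
  ... | inj₂ start = roundStart (proj₂ (nextRoundColours rule)) start

  aliceMove : ∀ p → Reachable p → turn p ≡ alice →
              Σ (Fin (N G)) λ v → Σ ℕ λ c → Available G p v × Smallest G 3 p v c × Reachable (move G p v c)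
  aliceMove _ initial _ =
    zero , 1 , refl ,
    (centre-legal (initPos G) (s≤s z≤n) (s≤s z≤n) (λ ()) (λ _ ()) , λ { 0 _ (() , _) ; (suc _) (s≤s ()) _ }) ,
    midRound firstRound (centreMove 1 2 (λ _ → refl) refl (λ _ → refl))
  aliceMove p (roundStart {a} {b} {c} t start) _ =
    zero , c , unchosen start zero , unique-legal⇒smallest G p zero legal unique ,
    midRound (laterRound (AllThree-swap₂₃ t)) (centreMove c b (unchosen start) (aliceToMove start) (leafColour start))
    where
    legal : Legal G 3 p zero c
    legal = let (1≤c , c≤3) = Colour₃-bounds (AllThree-colour₃ t)
            in centre-legal p 1≤c c≤3 (≢-just (centreColour start) (AllThree-≢₂₃ t))
                 (λ i → ≢-just (leafColour start i) (AllThree-≢₁₃ t))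
    unique : ∀ x → Legal G 3 p zero x → x ≡ c
    unique x (1≤x , x≤3 , own , nbrs) =
      AllThree-unique t (colour₃ 1≤x x≤3) (just-≢ (leafColour start zero) (nbrs (suc zero) refl) ∘ sym)
        (just-≢ (centreColour start) own ∘ sym)
  aliceMove p (midRound {a′ = a′} rule φ) _ with allTrue≡false⇒∃false (chosen p) (roundOngoing φ)
  ... | zero , unchosen = contradiction (trans (sym unchosen) (centreChosen φ)) λ ()
  ... | suc i , unchosen = suc i , a′ , unchosen , leaf-smallest i rule φ unchosen , leafMove i rule φ unchosen

  bobMove : ∀ p → Reachable p → turn p ≡ bob → ∀ v → Available G p v →
            ∃ (Legal G 3 p v) × (∀ c → Smallest G 3 p v c → Reachable (move G p v c))
  bobMove _ initial ()
  bobMove p (roundStart _ start) bob-moves = contradiction (trans (sym (aliceToMove start)) bob-moves) λ ()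
  bobMove p (midRound rule φ) _ zero available = contradiction (trans (sym available) (centreChosen φ)) λ ()
  bobMove p (midRound {a′ = a′} rule φ) _ (suc i) available =
    (a′ , proj₁ smallest) ,
    λ c greedy → subst (Reachable ∘ move G p (suc i)) (smallest-unique G p (suc i) smallest greedy)
                       (leafMove i rule φ available)
    where
    smallest : Smallest G 3 p (suc i) a′
    smallest = leaf-smallest i rule φ available

  wins : AliceWins true G 3
  wins = Reachable , initial , aliceMove , bobMove

three-colours-win-if-alice-opens-every-round : ∀ r → 1 ≤ r → parity (suc r) ≡ alice → AliceWins true (Star r) 3
three-colours-win-if-alice-opens-every-round (suc r) _ alice-opens = CentreFirst.wins r alice-opens

mainTheorem8 : (n : ℕ) → 2 ≤ n →
    IsChi AliceWins3 (Star (2 * n + 1)) 3 ×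
    ((k : ℕ) → k < 4 → ¬ AliceWins2 (Star (2 * n)) k)
mainTheorem8 n 2≤n =
  (three-colours-win-if-alice-opens-every-round (2 * n + 1) (m≤n+m 1 (2 * n)) alice-opens ,
   λ k k<3 → fewer-than-three-colours-lose (2 * n + 1) k (m≤n+m 1 (2 * n)) (≤-pred k<3) ∘ greedy-win⇒win) ,
  λ k k<4 → below-four k (≤-pred k<4)
  where
  alice-opens : parity (suc (2 * n + 1)) ≡ alice
  alice-opens = trans (cong (parity ∘ suc) (+-comm (2 * n) 1)) (trans (other-involutive _) (parity-even n))
  3≤2n : 3 ≤ 2 * n
  3≤2n = ≤-trans (s≤s (s≤s (s≤s z≤n))) (*-monoʳ-≤ 2 2≤n)
  below-four : ∀ k → k ≤ 3 → ¬ AliceWins2 (Star (2 * n)) k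
  below-four k k≤3 with m≤n⇒m<n∨m≡n k≤3
  ... | inj₁ k<3 = fewer-than-three-colours-lose (2 * n) k (≤-trans (s≤s z≤n) 3≤2n) (≤-pred k<3)
  ... | inj₂ refl = three-colours-lose-if-bob-opens-round-two (2 * n) 3≤2n (parity-odd n)
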